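{- Let $n\in\mathbb{N}$ and let $p\in\mathbb{Z}_3[x_1,\dots,x_n]$ be an expanded polynomial. Then one can construct a $\mathrm{CC}[3,2]$-circuit $C$ on inputs $x_1,\dots,x_n$ of size $O(|p|)$ such that for all $\mathbf{x}\in\{0,1\}^n$: $p((-1)^{x_1},\dots,(-1)^{x_n})=0$ if and only if $C(\mathbf{x})=1$.
   Context: An expanded polynomial is given as $\sum_{\mathbf{e}\in I}c_{\mathbf{e}}x_1^{e_1}\cdots x_n^{e_n}$ with $I\subseteq\{0,1,2\}^n$ and $c_{\mathbf{e}}\in\mathbb{Z}_3\setminus\{0\}$; $|p|$ is the size of this representation, and $p$ is evaluated in $\mathbb{Z}_3$. A $\mathrm{CC}[3,2]$-circuit is a depth-$2$ circuit with Boolean inputs and output whose output gate is a $\mathrm{MOD}_3$ gate and whose gates at the level adjacent to the inputs are $\mathrm{MOD}_2$ gates; a $\mathrm{MOD}_m$ gate has unbounded fan-in and outputs $1$ iff the sum of its inputs (counted with multiplicity) is divisible by $m$, else $0$; some input wires may carry the constant $1$. Equivalently, it is an expression $\mathrm{Mod}_3\big(c+\sum_{i}\mathrm{Mod}_2(c_i+\sum_m e_{i,m}x_m)\big)$ with nonnegative integer coefficients, where $\mathrm{Mod}_r(z)=1$ if $r\mid z$ and $0$ otherwise. The size is the number of gates. -}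

module Defs where

open import Data.Nat using (ℕ; zero; suc; _+_; _*_; _^_; _≡ᵇ_)
open import Data.Nat.DivMod using (_%_)
open import Data.Bool using (Bool; true; false; if_then_else_)
open import Data.Fin using (Fin; toℕ)
open import Data.List using (List; []; _∷_; map; length; foldr)
open import Data.Vec using (Vec; zipWith; toList)
open import Data.List.Relation.Unary.AllPairs using (AllPairs)
open import Relation.Binary.PropositionalEquality using (_≡_; _≢_)
open import Data.Product using (Σ; _×_; _,_; proj₁; proj₂)

sumℕ : List ℕ → ℕ
sumℕ = foldr _+_ 0

prodℕ : List ℕ → ℕ
prodℕ = foldr _*_ 1

-- Expanded polynomials over ℤ₃ in variables x₁ … xₙ.
-- A term is c · x₁^{e₁} ⋯ xₙ^{eₙ} with c ∈ ℤ₃ ∖ {0} and eᵢ ∈ {0,1,2}.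

record Term (n : ℕ) : Set where
  constructor term
  field
    coef    : Fin 3
    coef≢0  : toℕ coef ≢ 0
    exps    : Vec (Fin 3) n
open Term public

record ExpandedPoly (n : ℕ) : Set where
  constructor poly
  field
    terms    : List (Term n)
    distinct : AllPairs (λ s t → exps s ≢ exps t) terms
open ExpandedPoly public

∣_∣ₚ : ∀ {n} → ExpandedPoly n → ℕ
∣ p ∣ₚ = length (terms p)

-- (-1)^b in ℤ₃, represented by a natural number (-1 ≡ 2 mod 3).
signℕ : Bool → ℕ
signℕ false = 1
signℕ true  = 2

-- Value of a term at the point ((-1)^{x₁}, …, (-1)^{xₙ}), as a natural
-- number whose residue mod 3 is the value in ℤ₃.
termValℕ : ∀ {n} → Term n → Vec Bool n → ℕ
termValℕ t x = toℕ (coef t) * prodℕ (toList (zipWith (λ e b → signℕ b ^ toℕ e) (exps t) x))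

polyValℕ : ∀ {n} → ExpandedPoly n → Vec Bool n → ℕ
polyValℕ p x = sumℕ (map (λ t → termValℕ t x) (terms p))

evalSigned : ∀ {n} → ExpandedPoly n → Vec Bool n → ℕ
evalSigned p x = polyValℕ p x % 3

Mod : (r : ℕ) → ℕ → ℕ
Mod zero    z = if z ≡ᵇ 0 then 1 else 0
Mod (suc r) z = if (z % suc r) ≡ᵇ 0 then 1 else 0

bitℕ : Bool → ℕ
bitℕ false = 0
bitℕ true  = 1

-- A MOD₂ gate: constant cᵢ and multiplicities e_{i,m} of input wires.
record Mod2Gate (n : ℕ) : Set where
  constructor gate
  field
    const   : ℕ
    weights : Vec ℕ n
open Mod2Gate public

record CC32 (n : ℕ) : Set where
  constructor circuit
  field
    outConst : ℕ
    gates    : List (Mod2Gate n)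
open CC32 public

evalGate : ∀ {n} → Mod2Gate n → Vec Bool n → ℕ
evalGate g x = Mod 2 (const g + sumℕ (toList (zipWith (λ e b → e * bitℕ b) (weights g) x)))

evalCC32 : ∀ {n} → CC32 n → Vec Bool n → ℕ
evalCC32 C x = Mod 3 (outConst C + sumℕ (map (λ g → evalGate g x) (gates C)))

-- Size = number of gates (the MOD₂ gates plus the output MOD₃ gate).
sizeCC32 : ∀ {n} → CC32 n → ℕ
sizeCC32 C = suc (length (gates C))

{-# OPTIONS --safe #-}
module Submission where

-- Over ℤ₃ we have (-1)^w = 1 + [w odd], and [w odd] = Mod₂(1 + w). A term
-- c · ∏ᵢ (-1)^(eᵢ xᵢ) = c · (-1)^⟨e,x⟩ is therefore c + c · Mod₂(1 + ⟨e,x⟩):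
-- it contributes c to the constant of the MOD₃ gate and c ≤ 2 copies of the
-- MOD₂ gate with constant 1 and weights e. Summing over the terms, the input
-- of the MOD₃ gate is congruent to p((-1)^x₁, …, (-1)^xₙ) modulo 3.

open import Defs
open import Data.Nat using (ℕ; _≤_; _*_; _+_; zero; suc; z≤n; s≤s; _^_; NonZero)
open import Data.Nat.Properties
  using ( +-commutativeSemigroup; ^-zeroˡ; ^-distribˡ-+-*; *-zeroʳ; *-identityʳ; *-suc
        ; +-comm; +-mono-≤; n≤1+n; ≤-pred; module ≤-Reasoning)
open import Data.Nat.DivMod
  using (_%_; %-distribˡ-+; %-distribˡ-*; [m+kn]%n≡m%n; m%n<n; m<n⇒m%n≡m)
open import Data.Nat.ListAction.Properties using (sum-++)
open import Data.Nat.Solver using (module +-*-Solver)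
open import Data.Vec using (Vec; []; _∷_; zipWith; toList)
import Data.Vec as Vec
open import Data.List using (List; []; _∷_; _++_; map; length; replicate)
open import Data.List.Properties using (map-++; map-replicate; length-++; length-replicate)
open import Data.Bool using (Bool; true; false)
open import Data.Fin using (Fin; toℕ)
open import Data.Fin.Properties using (toℕ<n)
open import Data.Product using (Σ; ∃; _×_; _,_)
open import Function.Bundles using (_⇔_; mk⇔)
open import Relation.Binary.PropositionalEquality
  using (_≡_; refl; sym; cong; cong₂; subst; module ≡-Reasoning)
open import Algebra.Properties.CommutativeSemigroup +-commutativeSemigroup
  using (interchange)

private
  variable
    n : ℕ

module _ (d : ℕ) .{{_ : NonZero d}} where

  *-congˡ-% : ∀ m {a b} → a % d ≡ b % d → (m * a) % d ≡ (m * b) % d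
  *-congˡ-% m {a} {b} a≡b = begin
    (m * a) % d              ≡⟨ %-distribˡ-* m a d ⟩
    (m % d * (a % d)) % d    ≡⟨ cong (λ r → (m % d * r) % d) a≡b ⟩
    (m % d * (b % d)) % d    ≡⟨ %-distribˡ-* m b d ⟨
    (m * b) % d              ∎
    where open ≡-Reasoning

  +-cong-% : ∀ {a b c e} → a % d ≡ b % d → c % d ≡ e % d → (a + c) % d ≡ (b + e) % d
  +-cong-% {a} {b} {c} {e} a≡b c≡e = begin
    (a + c) % d              ≡⟨ %-distribˡ-+ a c d ⟩
    (a % d + c % d) % d      ≡⟨ cong₂ (λ r s → (r + s) % d) a≡b c≡e ⟩
    (b % d + e % d) % d      ≡⟨ %-distribˡ-+ b e d ⟨
    (b + e) % d              ∎
    where open ≡-Reasoning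

2^m%3≡1+m%2 : ∀ m → 2 ^ m % 3 ≡ suc (m % 2)
2^m%3≡1+m%2 0 = refl
2^m%3≡1+m%2 1 = refl
2^m%3≡1+m%2 (suc (suc m)) = begin
  2 ^ (2 + m) % 3            ≡⟨ cong (_% 3) (4*r≡r+r*3 (2 ^ m)) ⟩
  (2 ^ m + 2 ^ m * 3) % 3    ≡⟨ [m+kn]%n≡m%n (2 ^ m) (2 ^ m) 3 ⟩
  2 ^ m % 3                  ≡⟨ 2^m%3≡1+m%2 m ⟩
  suc (m % 2)                ∎
  where
  open ≡-Reasoning
  open +-*-Solver
  4*r≡r+r*3 : ∀ r → 2 * (2 * r) ≡ r + r * 3
  4*r≡r+r*3 = solve 1 (λ r → con 2 :* (con 2 :* r) := r :+ r :* con 3) refl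

Mod2[1+m]≡m%2 : ∀ m → Mod 2 (1 + m) ≡ m % 2
Mod2[1+m]≡m%2 0             = refl
Mod2[1+m]≡m%2 1             = refl
Mod2[1+m]≡m%2 (suc (suc m)) = Mod2[1+m]≡m%2 m

%3≡0⇔Mod3≡1 : ∀ m → m % 3 ≡ 0 ⇔ Mod 3 m ≡ 1
%3≡0⇔Mod3≡1 m with m % 3
... | zero  = mk⇔ (λ _ → refl) (λ _ → refl)
... | suc _ = mk⇔ (λ ()) (λ ())

signℕ^e≡2^[e*bitℕ] : ∀ b e → signℕ b ^ e ≡ 2 ^ (e * bitℕ b)
signℕ^e≡2^[e*bitℕ] false e = subst (λ k → 1 ^ e ≡ 2 ^ k) (sym (*-zeroʳ e)) (^-zeroˡ e)
signℕ^e≡2^[e*bitℕ] true  e = cong (2 ^_) (sym (*-identityʳ e))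

weightedBits : Vec ℕ n → Vec Bool n → ℕ
weightedBits ws x = sumℕ (toList (zipWith (λ e b → e * bitℕ b) ws x))

monomial : Vec (Fin 3) n → Vec Bool n → ℕ
monomial es x = prodℕ (toList (zipWith (λ e b → signℕ b ^ toℕ e) es x))

monomial≡2^weightedBits : ∀ (es : Vec (Fin 3) n) x →
  monomial es x ≡ 2 ^ weightedBits (Vec.map toℕ es) x
monomial≡2^weightedBits []       []      = refl
monomial≡2^weightedBits (e ∷ es) (b ∷ x) = begin
  signℕ b ^ toℕ e * monomial es x  ≡⟨ cong₂ _*_ (signℕ^e≡2^[e*bitℕ] b (toℕ e)) (monomial≡2^weightedBits es x) ⟩
  2 ^ (toℕ e * bitℕ b) * 2 ^ w     ≡⟨ ^-distribˡ-+-* 2 (toℕ e * bitℕ b) w ⟨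
  2 ^ (toℕ e * bitℕ b + w)         ∎
  where
  open ≡-Reasoning
  w = weightedBits (Vec.map toℕ es) x

outputSum : CC32 n → Vec Bool n → ℕ
outputSum C x = outConst C + sumℕ (map (λ g → evalGate g x) (gates C))

_⊕_ : CC32 n → CC32 n → CC32 n
C ⊕ D = circuit (outConst C + outConst D) (gates C ++ gates D)

outputSum-⊕ : ∀ (C D : CC32 n) x → outputSum (C ⊕ D) x ≡ outputSum C x + outputSum D x
outputSum-⊕ C D x = begin
  outConst C + outConst D + sumℕ (map ev (gates C ++ gates D))
    ≡⟨ cong (outConst C + outConst D +_) (cong sumℕ (map-++ ev (gates C) (gates D))) ⟩
  outConst C + outConst D + sumℕ (map ev (gates C) ++ map ev (gates D))
    ≡⟨ cong (outConst C + outConst D +_) (sum-++ (map ev (gates C)) (map ev (gates D))) ⟩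
  outConst C + outConst D + (sumℕ (map ev (gates C)) + sumℕ (map ev (gates D)))
    ≡⟨ interchange (outConst C) (outConst D) _ _ ⟩
  outputSum C x + outputSum D x
    ∎
  where
  open ≡-Reasoning
  ev : Mod2Gate _ → ℕ
  ev g = evalGate g x

parityGate : Term n → Mod2Gate n
parityGate t = gate 1 (Vec.map toℕ (exps t))

termCircuit : Term n → CC32 n
termCircuit t = circuit (toℕ (coef t)) (replicate (toℕ (coef t)) (parityGate t))

sum-replicate : ∀ k m → sumℕ (replicate k m) ≡ k * m
sum-replicate zero    m = refl
sum-replicate (suc k) m = cong (m +_) (sum-replicate k m)

outputSum-termCircuit : ∀ (t : Term n) x →
  outputSum (termCircuit t) x ≡ toℕ (coef t) * suc (evalGate (parityGate t) x)
outputSum-termCircuit t x = begin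
  c + sumℕ (map (λ g → evalGate g x) (replicate c (parityGate t)))
    ≡⟨ cong (λ l → c + sumℕ l) (map-replicate (λ g → evalGate g x) c (parityGate t)) ⟩
  c + sumℕ (replicate c (evalGate (parityGate t) x))
    ≡⟨ cong (c +_) (sum-replicate c _) ⟩
  c + c * evalGate (parityGate t) x
    ≡⟨ *-suc c _ ⟨
  c * suc (evalGate (parityGate t) x)
    ∎
  where
  open ≡-Reasoning
  c = toℕ (coef t)

termCircuit-correct : ∀ (t : Term n) x → termValℕ t x % 3 ≡ outputSum (termCircuit t) x % 3
termCircuit-correct t x = begin
  termValℕ t x % 3            ≡⟨ cong (λ r → (c * r) % 3) (monomial≡2^weightedBits (exps t) x) ⟩
  (c * 2 ^ w) % 3             ≡⟨ *-congˡ-% 3 c 2^w≡1+gate ⟩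
  (c * suc (Mod 2 (1 + w))) % 3 ≡⟨ cong (_% 3) (outputSum-termCircuit t x) ⟨
  outputSum (termCircuit t) x % 3 ∎
  where
  open ≡-Reasoning
  c = toℕ (coef t)
  w = weightedBits (Vec.map toℕ (exps t)) x
  2^w≡1+gate : 2 ^ w % 3 ≡ suc (Mod 2 (1 + w)) % 3
  2^w≡1+gate = begin
    2 ^ w % 3                 ≡⟨ 2^m%3≡1+m%2 w ⟩
    suc (w % 2)               ≡⟨ m<n⇒m%n≡m (s≤s (m%n<n w 2)) ⟨
    suc (w % 2) % 3           ≡⟨ cong (λ r → suc r % 3) (Mod2[1+m]≡m%2 w) ⟨
    suc (Mod 2 (1 + w)) % 3   ∎

polyCircuit : List (Term n) → CC32 n
polyCircuit []       = circuit 0 []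
polyCircuit (t ∷ ts) = termCircuit t ⊕ polyCircuit ts

polyCircuit-correct : ∀ (ts : List (Term n)) x →
  sumℕ (map (λ t → termValℕ t x) ts) % 3 ≡ outputSum (polyCircuit ts) x % 3
polyCircuit-correct []       x = refl
polyCircuit-correct (t ∷ ts) x = begin
  (v + vs) % 3                           ≡⟨ +-cong-% 3 {v} {o} {vs} {os} (termCircuit-correct t x) (polyCircuit-correct ts x) ⟩
  (o + os) % 3                           ≡⟨ cong (_% 3) (outputSum-⊕ (termCircuit t) (polyCircuit ts) x) ⟨
  outputSum (polyCircuit (t ∷ ts)) x % 3 ∎
  where
  open ≡-Reasoning
  v  = termValℕ t x
  vs = sumℕ (map (λ t → termValℕ t x) ts)
  o  = outputSum (termCircuit t) x
  os = outputSum (polyCircuit ts) x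

length-gates-polyCircuit : ∀ (ts : List (Term n)) → length (gates (polyCircuit ts)) ≤ 2 * length ts
length-gates-polyCircuit []       = z≤n
length-gates-polyCircuit (t ∷ ts) = begin
  length (replicate c (parityGate t) ++ gates (polyCircuit ts))
    ≡⟨ length-++ (replicate c (parityGate t)) ⟩
  length (replicate c (parityGate t)) + length (gates (polyCircuit ts))
    ≡⟨ cong (_+ _) (length-replicate c) ⟩
  c + length (gates (polyCircuit ts))
    ≤⟨ +-mono-≤ (≤-pred (toℕ<n (coef t))) (length-gates-polyCircuit ts) ⟩
  2 + 2 * length ts
    ≡⟨ *-suc 2 (length ts) ⟨
  2 * length (t ∷ ts)
    ∎
  where
  open ≤-Reasoning
  c = toℕ (coef t)

sizeCC32-polyCircuit : ∀ (ts : List (Term n)) → sizeCC32 (polyCircuit ts) ≤ 2 * (length ts + 1)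
sizeCC32-polyCircuit ts = begin
  suc (length (gates (polyCircuit ts))) ≤⟨ s≤s (length-gates-polyCircuit ts) ⟩
  suc (2 * length ts)                   ≤⟨ n≤1+n _ ⟩
  2 + 2 * length ts                     ≡⟨ *-suc 2 (length ts) ⟨
  2 * suc (length ts)                   ≡⟨ cong (2 *_) (+-comm 1 (length ts)) ⟩
  2 * (length ts + 1)                   ∎
  where open ≤-Reasoning

lemma7p1 : ∃ λ (k : ℕ) → (n : ℕ) (p : ExpandedPoly n) →
             Σ (CC32 n) λ C →
               (sizeCC32 C ≤ k * (∣ p ∣ₚ + 1)) ×
               ((x : Vec Bool n) → (evalSigned p x ≡ 0 ⇔ evalCC32 C x ≡ 1))
lemma7p1 = 2 , λ n p → let ts = terms p in
  polyCircuit ts , sizeCC32-polyCircuit ts , λ x →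
    subst (λ r → r ≡ 0 ⇔ evalCC32 (polyCircuit ts) x ≡ 1)
          (sym (polyCircuit-correct ts x))
          (%3≡0⇔Mod3≡1 (outputSum (polyCircuit ts) x))
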